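{- Let $G$ be a graph with color set $\mathcal{C}$, color function $\lambda:E(G)\to2^{\mathcal{C}}\setminus\{\emptyset\}$ and weights $\gamma(e,c)\in\mathbb{Q}_{\ge0}$ for $e\in E(G)$, $c\in\lambda(e)$, and let $G'$, $\gamma'$ and $H'$ be constructed as in the context. Then there is a perfect over-the-rainbow matching of weight $\ell$ in $G$ if and only if there is a perfect conjoining matching of weight $\ell$ in $G'$ with respect to $H'$.
   Context: A perfect over-the-rainbow matching of $G$ is a pair $(M,\xi)$ where $M$ is a perfect matching of $G$ and $\xi:M\to\mathcal{C}$ is surjective with $\xi(e)\in\lambda(e)$ for all $e\in M$; its weight is $\sum_{e\in M}\gamma(e,\xi(e))$. Construction: for each $c\in\mathcal{C}$ let $G_c$ be the graph with vertex set $\{v_c\mid v\in V(G)\}$ and edge set $\{\{v_c,w_c\}\mid \{v,w\}\in E(G), c\in\lambda(\{v,w\})\}$. For each $v\in V(G)$ let $J(v)$ be a set of $|\mathcal{C}|-1$ new vertices. $G'$ is the disjoint union of all $G_c$ and all $J(v)$, together with the edges $\{v_c,x\}$ for all $v\in V(G)$, $c\in\mathcal{C}$, $x\in J(v)$. Weights: $\gamma'(\{v_c,w_c\})=\gamma(\{v,w\},c)$ for edges of $G_c$, and $\gamma'(e)=0$ for all other edges. Let $J=\bigcup_{v\in V(G)}J(v)$; the vertex partition of $G'$ is $V(G_1),\dots,V(G_{|\mathcal{C}|}),J$, and $H'$ is the graph on vertex set $\{V(G_c)\mid c\in\mathcal{C}\}\cup\{J\}$ whose edges are exactly the self-loops $\{V(G_c),V(G_c)\}$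 for $c\in\mathcal{C}$. A perfect conjoining matching of $G'$ with respect to $H'$ is a perfect matching $M'$ of $G'$ such that for every $c\in\mathcal{C}$, $M'$ contains an edge with both endpoints in $V(G_c)$; its weight is $\sum_{e\in M'}\gamma'(e)$. -}

module Defs where

open import Data.Nat using (ℕ; zero; suc; _∸_)
open import Data.Fin using (Fin; zero; suc; _≟_)
open import Data.List using (List; length; lookup)
open import Data.Product using (Σ; ∃; _×_; _,_)
open import Data.Sum using (_⊎_)
open import Data.Empty using (⊥)
open import Data.Bool using (if_then_else_)
open import Data.Rational using (ℚ; 0ℚ; _+_)
open import Relation.Nullary using (does)
open import Relation.Binary.PropositionalEquality using (_≡_)

∑ : ∀ {m} → (Fin m → ℚ) → ℚ
∑ {zero}  f = 0ℚ
∑ {suc m} f = f zero + ∑ (λ i → f (suc i))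

-- Generic graphs on a vertex type V, given by an adjacency relation.
-- An edge {a,b} of a matching is stored as an ordered pair (a , b).

_∈e_ : ∀ {V : Set} → V → V × V → Set
v ∈e (a , b) = (v ≡ a) ⊎ (v ≡ b)

record PerfectMatching {V : Set} (Adj : V → V → Set) : Set where
  field
    edges  : List (V × V)
    isEdge : ∀ (i : Fin (length edges)) → Adj (Data.Product.proj₁ (lookup edges i))
                                                (Data.Product.proj₂ (lookup edges i))
    cover  : ∀ (v : V) → Σ (Fin (length edges)) (λ i → v ∈e lookup edges i)
    unique : ∀ (v : V) (i j : Fin (length edges)) →
             v ∈e lookup edges i → v ∈e lookup edges j → i ≡ j

open PerfectMatching public

edgeW : ∀ {V : Set} → (V → V → ℚ) → V × V → ℚ
edgeW w (a , b) = w a b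

-- Coloured graph G on vertices Fin n with colours Fin k.
--   Adj : adjacency relation of G
--   col : col v w c  means  c ∈ λ({v,w})
--   γ   : γ v w c  is  γ({v,w}, c)

record PerfectOTRMatching {n k : ℕ} (Adj : Fin n → Fin n → Set)
         (col : Fin n → Fin n → Fin k → Set) : Set where
  field
    M       : PerfectMatching Adj
    ξ       : Fin (length (edges M)) → Fin k
    ξ-col   : ∀ i → col (Data.Product.proj₁ (lookup (edges M) i))
                        (Data.Product.proj₂ (lookup (edges M) i)) (ξ i)
    ξ-surj  : ∀ (c : Fin k) → ∃ (λ i → ξ i ≡ c)

open PerfectOTRMatching public

otrWeight : ∀ {n k} {Adj : Fin n → Fin n → Set} {col : Fin n → Fin n → Fin k → Set}
            (γ : Fin n → Fin n → Fin k → ℚ) → PerfectOTRMatching Adj col → ℚ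
otrWeight γ P = ∑ (λ i → γ (Data.Product.proj₁ (lookup (edges (M P)) i))
                           (Data.Product.proj₂ (lookup (edges (M P)) i)) (ξ P i))

-- The construction of G'.
-- Vertices: v_c  (copy v c) for v ∈ V(G), c ∈ C, and the |C|-1 new
-- vertices of J(v)  (junk v x), x ∈ Fin (k ∸ 1).

data V' (n k : ℕ) : Set where
  copy : Fin n → Fin k → V' n k
  junk : Fin n → Fin (k ∸ 1) → V' n k

data Adj' {n k : ℕ} (Adj : Fin n → Fin n → Set)
          (col : Fin n → Fin n → Fin k → Set) : V' n k → V' n k → Set where
  inGc  : ∀ {v w c} → Adj v w → col v w c → Adj' Adj col (copy v c) (copy w c)
  -- edges {v_c , x} for x ∈ J(v) (in both orientations, G' is undirected)
  toJ   : ∀ {v c x} → Adj' Adj col (copy v c) (junk v x)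
  fromJ : ∀ {v c x} → Adj' Adj col (junk v x) (copy v c)

-- Weights γ' (only meaningful on edges of G')
γ' : ∀ {n k} → (Fin n → Fin n → Fin k → ℚ) → V' n k → V' n k → ℚ
γ' γ (copy v c) (copy w d) = if does (c Data.Fin.≟ d) then γ v w c else 0ℚ
γ' γ (copy v c) (junk w x) = 0ℚ
γ' γ (junk v x) b          = 0ℚ

InGc : ∀ {n k} → Fin k → V' n k → Set
InGc c (copy v d) = d ≡ c
InGc c (junk v x) = ⊥

-- Perfect conjoining matching of G' w.r.t. H' (H' has exactly the
-- self-loops at the parts V(G_c), so the condition is: for each colour c
-- some matching edge has both endpoints in V(G_c)).
record PerfectConjoiningMatching {n k : ℕ} (Adj : Fin n → Fin n → Set)
         (col : Fin n → Fin n → Fin k → Set) : Set where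
  field
    M'       : PerfectMatching (Adj' Adj col)
    conjoin  : ∀ (c : Fin k) → ∃ (λ i →
                 InGc c (Data.Product.proj₁ (lookup (edges M') i)) ×
                 InGc c (Data.Product.proj₂ (lookup (edges M') i)))

open PerfectConjoiningMatching public

conjWeight : ∀ {n k} {Adj : Fin n → Fin n → Set} {col : Fin n → Fin n → Fin k → Set}
             (γ : Fin n → Fin n → Fin k → ℚ) → PerfectConjoiningMatching Adj col → ℚ
conjWeight γ P = ∑ (λ i → edgeW (γ' γ) (lookup (edges (M' P)) i))

-- An over-the-rainbow matching (M , ξ) becomes a conjoining matching of G' by
-- lifting every edge e of M into the layer G_ξ(e) and matching the |C| - 1
-- vertices of J(v) with the copies v_c, c ≠ ξ(edge of v); these extra edges
-- weigh 0. Conversely, in a perfect matching of G' the vertices of J(v) are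
-- matched injectively to copies of v, so exactly one copy of each vertex v is
-- matched inside its layer. The layer edges of the matching therefore project
-- to a perfect matching of G, coloured by their layers; the conjoining
-- condition makes this colouring surjective, and the weights agree edge by edge.
module Submission where

open import Data.Nat using (ℕ; zero; suc; _≤_; _+_; _*_; _∸_; s≤s; z≤n)
open import Data.Nat.Properties using (1+n≰n)
open import Data.Fin using (Fin; zero; suc; cast; splitAt; punchIn; punchOut; _≟_)
open import Data.Fin.Properties
  using (cast-is-id; cast-involutive; suc-injective; +↔⊎; *↔×; injective⇒≤; any?; ¬∀⟶∃¬;
         punchIn-injective; punchInᵢ≢i; punchIn-punchOut; punchOut-injective)
open import Data.List using (List; length; lookup; tabulate)
open import Data.List.Properties using (length-tabulate; lookup-tabulate)
open import Data.Product using (Σ; ∃; _×_; _,_; proj₁; proj₂)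
open import Data.Sum using (_⊎_; inj₁; inj₂)
import Data.Sum as Sum
open import Data.Sum.Function.Propositional using (_⊎-↔_)
open import Data.Empty using (⊥; ⊥-elim)
open import Data.Rational using (ℚ; 0ℚ) renaming (_+_ to _+ℚ_; _≤_ to _≤ℚ_)
open import Data.Rational.Properties using (+-assoc; +-identityˡ; +-identityʳ)
open import Function using (_∘_)
open import Function.Bundles using (_↔_; Inverse; _⇔_; mk⇔)
open import Function.Properties.Inverse using (↔-refl; ↔-trans)
open import Relation.Nullary using (¬_; Dec; yes; no)
open import Relation.Binary.PropositionalEquality
open ≡-Reasoning

open import Defs

∑-cong : ∀ {m} {f g : Fin m → ℚ} → (∀ i → f i ≡ g i) → ∑ f ≡ ∑ g
∑-cong {zero}  f≗g = refl
∑-cong {suc m} f≗g = cong₂ _+ℚ_ (f≗g zero) (∑-cong (f≗g ∘ suc))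

∑-zero : ∀ {m} {f : Fin m → ℚ} → (∀ i → f i ≡ 0ℚ) → ∑ f ≡ 0ℚ
∑-zero {zero}  f≗0 = refl
∑-zero {suc m} f≗0 = trans (cong₂ _+ℚ_ (f≗0 zero) (∑-zero (f≗0 ∘ suc))) (+-identityˡ 0ℚ)

∑-cast : ∀ {a b} (eq : a ≡ b) (f : Fin b → ℚ) → ∑ (f ∘ cast eq) ≡ ∑ f
∑-cast refl f = ∑-cong (cong f ∘ cast-is-id refl)

∑-splitAt : ∀ a {b} (f : Fin a ⊎ Fin b → ℚ) →
            ∑ (f ∘ splitAt a) ≡ ∑ (f ∘ inj₁) +ℚ ∑ (f ∘ inj₂)
∑-splitAt zero    f = sym (+-identityˡ _)
∑-splitAt (suc a) f = begin
  f (inj₁ zero) +ℚ ∑ (f ∘ Sum.map₁ suc ∘ splitAt a)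
    ≡⟨ cong (f (inj₁ zero) +ℚ_) (∑-splitAt a (f ∘ Sum.map₁ suc)) ⟩
  f (inj₁ zero) +ℚ (∑ (f ∘ inj₁ ∘ suc) +ℚ ∑ (f ∘ inj₂))
    ≡⟨ sym (+-assoc (f (inj₁ zero)) _ _) ⟩
  ∑ (f ∘ inj₁) +ℚ ∑ (f ∘ inj₂) ∎

record Enumeration {N : ℕ} (P : Fin N → Set) : Set where
  field
    size           : ℕ
    elem           : Fin size → Fin N
    elem-P         : ∀ j → P (elem j)
    elem-injective : ∀ {j j′} → elem j ≡ elem j′ → j ≡ j′
    elem-onto      : ∀ i → P i → ∃ λ j → elem j ≡ i
    ∑-elem         : ∀ f → (∀ i → ¬ P i → f i ≡ 0ℚ) → ∑ f ≡ ∑ (f ∘ elem)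

module _ {N : ℕ} {P : Fin (suc N) → Set} (E : Enumeration (P ∘ suc)) where
  open Enumeration E

  Enumeration-include : P zero → Enumeration P
  Enumeration-include p = record
    { size           = suc size
    ; elem           = elem′
    ; elem-P         = λ { zero → p ; (suc j) → elem-P j }
    ; elem-injective = elem′-injective
    ; elem-onto      = λ { zero _ → zero , refl
                         ; (suc i) q → let (j , eq) = elem-onto i q in suc j , cong suc eq }
    ; ∑-elem         = λ f f≗0 → cong (f zero +ℚ_) (∑-elem (f ∘ suc) (f≗0 ∘ suc))
    }
    where
    elem′ : Fin (suc size) → Fin (suc N)
    elem′ zero    = zero
    elem′ (suc j) = suc (elem j)
    elem′-injective : ∀ {j j′} → elem′ j ≡ elem′ j′ → j ≡ j′
    elem′-injective {zero}  {zero}   _  = refl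
    elem′-injective {suc j} {suc j′} eq = cong suc (elem-injective (suc-injective eq))

  Enumeration-exclude : ¬ P zero → Enumeration P
  Enumeration-exclude ¬p = record
    { size           = size
    ; elem           = suc ∘ elem
    ; elem-P         = elem-P
    ; elem-injective = elem-injective ∘ suc-injective
    ; elem-onto      = λ { zero q → ⊥-elim (¬p q)
                         ; (suc i) q → let (j , eq) = elem-onto i q in j , cong suc eq }
    ; ∑-elem         = λ f f≗0 → begin
        f zero +ℚ ∑ (f ∘ suc) ≡⟨ cong (_+ℚ ∑ (f ∘ suc)) (f≗0 zero ¬p) ⟩
        0ℚ +ℚ ∑ (f ∘ suc)     ≡⟨ +-identityˡ _ ⟩
        ∑ (f ∘ suc)           ≡⟨ ∑-elem (f ∘ suc) (f≗0 ∘ suc) ⟩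
        ∑ (f ∘ suc ∘ elem)    ∎
    }

enumerate : ∀ {N} {P : Fin N → Set} → (∀ i → Dec (P i)) → Enumeration P
enumerate {zero} P? = record
  { size = 0 ; elem = λ () ; elem-P = λ () ; elem-injective = λ { {()} } ; elem-onto = λ ()
  ; ∑-elem = λ _ _ → refl }
enumerate {suc N} P? with P? zero
... | yes p = Enumeration-include (enumerate (P? ∘ suc)) p
... | no ¬p = Enumeration-exclude (enumerate (P? ∘ suc)) ¬p

missedValue : ∀ {k} (φ : Fin k → Fin (suc k)) → ∃ λ c → ∀ x → φ x ≢ c
missedValue {k} φ =
  let (c , c∉image) = ¬∀⟶∃¬ (suc k) (λ c → ∃ λ x → φ x ≡ c) (λ c → any? (λ x → φ x ≟ c)) ¬surjective
  in c , λ x φx≡c → c∉image (x , φx≡c)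
  where
  ¬surjective : ¬ (∀ c → ∃ λ x → φ x ≡ c)
  ¬surjective onto = 1+n≰n (injective⇒≤ section-injective)
    where
    section-injective : ∀ {c d} → proj₁ (onto c) ≡ proj₁ (onto d) → c ≡ d
    section-injective {c} {d} eq =
      trans (sym (proj₂ (onto c))) (trans (cong φ eq) (proj₂ (onto d)))

missedValue-unique : ∀ {k} (φ : Fin k → Fin (suc k)) → (∀ {x y} → φ x ≡ φ y → x ≡ y) →
                     ∀ {c d} → (∀ x → φ x ≢ c) → (∀ x → φ x ≢ d) → c ≡ d
missedValue-unique {zero}  φ φ-injective {zero} {zero} _ _ = refl
missedValue-unique {suc k} φ φ-injective {c} {d} c∉image d∉image with c ≟ d
... | yes c≡d = c≡d
... | no  c≢d = ⊥-elim (1+n≰n (injective⇒≤ squeezed-injective))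
  where
  -- Punching out the two missed values squeezes φ injectively into Fin k.
  c≢φ : ∀ x → c ≢ φ x
  c≢φ x = c∉image x ∘ sym
  d′≢φ : ∀ x → punchOut c≢d ≢ punchOut (c≢φ x)
  d′≢φ x eq = d∉image x (sym (punchOut-injective c≢d (c≢φ x) eq))
  squeezed-injective : ∀ {x y} → punchOut (d′≢φ x) ≡ punchOut (d′≢φ y) → x ≡ y
  squeezed-injective {x} {y} eq =
    φ-injective (punchOut-injective (c≢φ x) (c≢φ y) (punchOut-injective (d′≢φ x) (d′≢φ y) eq))

record IsPerfectFamily {V I : Set} (Adj : V → V → Set) (F : I → V × V) : Set where
  field
    adjacent : ∀ x → Adj (proj₁ (F x)) (proj₂ (F x))
    covering : ∀ v → ∃ λ x → v ∈e F x
    disjoint : ∀ v x y → v ∈e F x → v ∈e F y → x ≡ y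

module FromFamily {V I : Set} {Adj : V → V → Set} {N : ℕ} (enum : Fin N ↔ I)
                  {F : I → V × V} (isPerfect : IsPerfectFamily Adj F) where
  open Inverse enum using (to; from; strictlyInverseˡ; strictlyInverseʳ)
  open IsPerfectFamily isPerfect

  edgeList : List (V × V)
  edgeList = tabulate (F ∘ to)

  length-edgeList : length edgeList ≡ N
  length-edgeList = length-tabulate (F ∘ to)

  index : Fin (length edgeList) → I
  index = to ∘ cast length-edgeList

  position : I → Fin (length edgeList)
  position = cast (sym length-edgeList) ∘ from

  position-index : ∀ i → position (index i) ≡ i
  position-index i = begin
    cast (sym length-edgeList) (from (to (cast length-edgeList i)))
      ≡⟨ cong (cast (sym length-edgeList)) (strictlyInverseʳ _) ⟩
    cast (sym length-edgeList) (cast length-edgeList i)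
      ≡⟨ cast-involutive (sym length-edgeList) length-edgeList i ⟩
    i ∎

  lookup-position : ∀ x → lookup edgeList (position x) ≡ F x
  lookup-position x = trans (lookup-tabulate (F ∘ to) (from x)) (cong F (strictlyInverseˡ x))

  lookup-edgeList : ∀ i → lookup edgeList i ≡ F (index i)
  lookup-edgeList i = begin
    lookup edgeList i                  ≡⟨ cong (lookup edgeList) (sym (position-index i)) ⟩
    lookup edgeList (position (index i)) ≡⟨ lookup-position (index i) ⟩
    F (index i)                        ∎

  perfectMatching : PerfectMatching Adj
  perfectMatching = record
    { edges  = edgeList
    ; isEdge = λ i → subst (λ e → Adj (proj₁ e) (proj₂ e)) (sym (lookup-edgeList i)) (adjacent (index i))
    ; cover  = λ v → let (x , v∈x) = covering v in
                     position x , subst (v ∈e_) (sym (lookup-position x)) v∈x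
    ; unique = λ v i j v∈i v∈j → begin
        i                    ≡⟨ sym (position-index i) ⟩
        position (index i)   ≡⟨ cong position (disjoint v _ _ (subst (v ∈e_) (lookup-edgeList i) v∈i)
                                                             (subst (v ∈e_) (lookup-edgeList j) v∈j)) ⟩
        position (index j)   ≡⟨ position-index j ⟩
        j                    ∎
    }

  ∑-edgeList : (g : Fin N → V × V → ℚ) →
               ∑ (λ i → g (cast length-edgeList i) (lookup edgeList i)) ≡ ∑ (λ j → g j (F (to j)))
  ∑-edgeList g = begin
    ∑ (λ i → g (cast length-edgeList i) (lookup edgeList i))
      ≡⟨ ∑-cong (cong (g (cast length-edgeList _)) ∘ lookup-edgeList) ⟩
    ∑ (λ i → g (cast length-edgeList i) (F (index i)))
      ≡⟨ ∑-cast length-edgeList (λ j → g j (F (to j))) ⟩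
    ∑ (λ j → g j (F (to j))) ∎

module _ {n k : ℕ} where

  copy-injective : ∀ {a b : Fin n} {c d : Fin k} → copy a c ≡ copy b d → a ≡ b × c ≡ d
  copy-injective refl = refl , refl

  data LayerEdge : V' n k × V' n k → Set where
    layerEdge : ∀ a b c → LayerEdge (copy a c , copy b c)

  endpoints : ∀ {e} → LayerEdge e → Fin n × Fin n
  endpoints (layerEdge a b c) = a , b

  colour : ∀ {e} → LayerEdge e → Fin k
  colour (layerEdge a b c) = c

  colour-unique : ∀ {e e′} → e ≡ e′ → (p : LayerEdge e) (q : LayerEdge e′) → colour p ≡ colour q
  colour-unique refl (layerEdge a b c) (layerEdge .a .b .c) = refl

  layerEdge-∋copy : ∀ {e v c} (p : LayerEdge e) → copy v c ∈e e → v ∈e endpoints p × c ≡ colour p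
  layerEdge-∋copy (layerEdge a b c) (inj₁ refl) = inj₁ refl , refl
  layerEdge-∋copy (layerEdge a b c) (inj₂ refl) = inj₂ refl , refl

  layerEdge-∋endpoint : ∀ {e v} (p : LayerEdge e) → v ∈e endpoints p → copy v (colour p) ∈e e
  layerEdge-∋endpoint (layerEdge a b c) (inj₁ refl) = inj₁ refl
  layerEdge-∋endpoint (layerEdge a b c) (inj₂ refl) = inj₂ refl

  layerEdge-∌junk : ∀ {e v x} → LayerEdge e → ¬ junk v x ∈e e
  layerEdge-∌junk (layerEdge a b c) (inj₁ ())
  layerEdge-∌junk (layerEdge a b c) (inj₂ ())

  data JunkEdge (v : Fin n) (c : Fin k) (x : Fin (k ∸ 1)) : V' n k × V' n k → Set where
    copy─junk : JunkEdge v c x (copy v c , junk v x)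
    junk─copy : JunkEdge v c x (junk v x , copy v c)

  junkEdge-∋copy : ∀ {v c x e} → JunkEdge v c x e → copy v c ∈e e
  junkEdge-∋copy copy─junk = inj₁ refl
  junkEdge-∋copy junk─copy = inj₂ refl

  junkEdge-∋junk : ∀ {v c x e} → JunkEdge v c x e → junk v x ∈e e
  junkEdge-∋junk copy─junk = inj₂ refl
  junkEdge-∋junk junk─copy = inj₁ refl

  junkEdge-copy : ∀ {v c x e w d} → JunkEdge v c x e → copy w d ∈e e → w ≡ v × d ≡ c
  junkEdge-copy copy─junk (inj₁ refl) = refl , refl
  junkEdge-copy junk─copy (inj₂ refl) = refl , refl

  junkEdge-junk : ∀ {v c x e w y} → JunkEdge v c x e → junk w y ∈e e → w ≡ v × y ≡ x
  junkEdge-junk copy─junk (inj₂ refl) = refl , refl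
  junkEdge-junk junk─copy (inj₁ refl) = refl , refl

  junkEdge-¬layerEdge : ∀ {v c x e} → JunkEdge v c x e → ¬ LayerEdge e
  junkEdge-¬layerEdge p q = layerEdge-∌junk q (junkEdge-∋junk p)

  module _ {Adj : Fin n → Fin n → Set} {col : Fin n → Fin n → Fin k → Set} where

    layerEdge? : ∀ {a b} → Adj' Adj col a b → Dec (LayerEdge (a , b))
    layerEdge? (inGc _ _) = yes (layerEdge _ _ _)
    layerEdge? toJ        = no λ ()
    layerEdge? fromJ      = no λ ()

    layerEdge-adjacent : ∀ {a b} (p : LayerEdge (a , b)) → Adj' Adj col a b →
                         let (v , w) = endpoints p in Adj v w × col v w (colour p)
    layerEdge-adjacent (layerEdge _ _ _) (inGc vw c∈λvw) = vw , c∈λvw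

    inLayer⇒layerEdge : ∀ {a b} c → Adj' Adj col a b → InGc c a → InGc c b →
                        Σ (LayerEdge (a , b)) (λ p → colour p ≡ c)
    inLayer⇒layerEdge c (inGc _ _) refl _ = layerEdge _ _ _ , refl

    junk∈edge : ∀ {a b v x} → Adj' Adj col a b → junk v x ∈e (a , b) → ∃ λ c → JunkEdge v c x (a , b)
    junk∈edge toJ   (inj₂ refl) = _ , copy─junk
    junk∈edge fromJ (inj₁ refl) = _ , junk─copy

    copy∈edge : ∀ {a b v c} → Adj' Adj col a b → copy v c ∈e (a , b) →
                LayerEdge (a , b) ⊎ ∃ λ x → JunkEdge v c x (a , b)
    copy∈edge (inGc _ _) _           = inj₁ (layerEdge _ _ _)
    copy∈edge toJ        (inj₁ refl) = inj₂ (_ , copy─junk)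
    copy∈edge fromJ      (inj₂ refl) = inj₂ (_ , junk─copy)

  module _ (γ : Fin n → Fin n → Fin k → ℚ) where

    weight-layerEdge : ∀ {e} (p : LayerEdge e) →
                       edgeW (γ' γ) e ≡ γ (proj₁ (endpoints p)) (proj₂ (endpoints p)) (colour p)
    weight-layerEdge (layerEdge a b c) with c ≟ c
    ... | yes _  = refl
    ... | no c≢c = ⊥-elim (c≢c refl)

    weight-¬layerEdge : ∀ e → ¬ LayerEdge e → edgeW (γ' γ) e ≡ 0ℚ
    weight-¬layerEdge (copy a c , copy b d) ¬layer with c ≟ d
    ... | yes refl = ⊥-elim (¬layer (layerEdge a b c))
    ... | no _     = refl
    weight-¬layerEdge (copy _ _ , junk _ _) _ = refl
    weight-¬layerEdge (junk _ _ , _)        _ = refl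

module FromOTR {n k : ℕ} {Adj : Fin n → Fin n → Set} {col : Fin n → Fin n → Fin (suc k) → Set}
               (P : PerfectOTRMatching Adj col) where
  open PerfectMatching (M P) using () renaming (edges to edgesM; unique to uniqueM)

  m : ℕ
  m = length edgesM

  edge : Fin m → Fin n × Fin n
  edge = lookup edgesM

  colourAt : Fin n → Fin (suc k)
  colourAt v = ξ P (proj₁ (cover (M P) v))

  Index : Set
  Index = Fin m ⊎ (Fin n × Fin k)

  enum : Fin (m + n * k) ↔ Index
  enum = ↔-trans +↔⊎ (↔-refl ⊎-↔ *↔×)

  F : Index → V' n (suc k) × V' n (suc k)
  F (inj₁ i)       = copy (proj₁ (edge i)) (ξ P i) , copy (proj₂ (edge i)) (ξ P i)
  F (inj₂ (v , x)) = copy v (punchIn (colourAt v) x) , junk v x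

  layer : ∀ i → LayerEdge (F (inj₁ i))
  layer i = layerEdge _ _ (ξ P i)

  covering : ∀ u → ∃ λ x → u ∈e F x
  covering (copy v c) with colourAt v ≟ c
  ... | yes refl = inj₁ (proj₁ (cover (M P) v)) , layerEdge-∋endpoint (layer _) (proj₂ (cover (M P) v))
  ... | no  colour≢c = inj₂ (v , punchOut colour≢c) , inj₁ (cong (copy v) (sym (punchIn-punchOut colour≢c)))
  covering (junk v x) = inj₂ (v , x) , inj₂ refl

  layer-junk-disjoint : ∀ {u i v x} → u ∈e F (inj₁ i) → u ∈e F (inj₂ (v , x)) → ⊥
  layer-junk-disjoint {i = i} {v} {x} u∈i (inj₁ refl) = punchInᵢ≢i (colourAt v) x (begin
    punchIn (colourAt v) x         ≡⟨ proj₂ (layerEdge-∋copy (layer i) u∈i) ⟩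
    ξ P i                          ≡⟨ cong (ξ P) (uniqueM v _ _ (proj₁ (layerEdge-∋copy (layer i) u∈i))
                                                                (proj₂ (cover (M P) v))) ⟩
    colourAt v                     ∎)
  layer-junk-disjoint {i = i} u∈i (inj₂ refl) = layerEdge-∌junk (layer i) u∈i

  disjoint : ∀ u x y → u ∈e F x → u ∈e F y → x ≡ y
  disjoint u (inj₁ i) (inj₂ _) u∈i u∈x = ⊥-elim (layer-junk-disjoint u∈i u∈x)
  disjoint u (inj₂ _) (inj₁ j) u∈x u∈j = ⊥-elim (layer-junk-disjoint u∈j u∈x)
  disjoint (copy v c) (inj₁ i) (inj₁ j) v∈i v∈j =
    cong inj₁ (uniqueM v i j (proj₁ (layerEdge-∋copy (layer i) v∈i)) (proj₁ (layerEdge-∋copy (layer j) v∈j)))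
  disjoint (junk v x) (inj₁ i) (inj₁ _) v∈i _ = ⊥-elim (layerEdge-∌junk (layer i) v∈i)
  disjoint _ (inj₂ (v , x)) (inj₂ (w , y)) (inj₁ refl) (inj₁ eq) with copy-injective eq
  ... | refl , c≡c′ = cong (λ y → inj₂ (v , y)) (punchIn-injective (colourAt v) x y c≡c′)
  disjoint _ (inj₂ _) (inj₂ _) (inj₂ refl) (inj₂ refl) = refl

  isPerfect : IsPerfectFamily (Adj' Adj col) F
  isPerfect = record
    { adjacent = λ { (inj₁ i) → inGc (isEdge (M P) i) (ξ-col P i) ; (inj₂ _) → toJ }
    ; covering = covering
    ; disjoint = disjoint
    }

  open FromFamily enum isPerfect

  conjoining : PerfectConjoiningMatching Adj col
  conjoining = record
    { M'      = perfectMatching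
    ; conjoin = λ c → let (i , ξi≡c) = ξ-surj P c in
        position (inj₁ i) ,
        subst (λ e → InGc c (proj₁ e) × InGc c (proj₂ e)) (sym (lookup-position (inj₁ i))) (ξi≡c , ξi≡c)
    }

  conjWeight≡otrWeight : ∀ γ → conjWeight γ conjoining ≡ otrWeight γ P
  conjWeight≡otrWeight γ = begin
    conjWeight γ conjoining
      ≡⟨ ∑-edgeList (λ _ → edgeW (γ' γ)) ⟩
    ∑ (edgeW (γ' γ) ∘ F ∘ Inverse.to enum)
      ≡⟨ ∑-splitAt m (edgeW (γ' γ) ∘ F ∘ Inverse.to (↔-refl ⊎-↔ *↔×)) ⟩
    ∑ (edgeW (γ' γ) ∘ F ∘ inj₁) +ℚ ∑ (edgeW (γ' γ) ∘ F ∘ inj₂ ∘ Inverse.to *↔×)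
      ≡⟨ cong₂ _+ℚ_ (∑-cong (weight-layerEdge γ ∘ layer)) (∑-zero {n * k} (λ _ → refl)) ⟩
    otrWeight γ P +ℚ 0ℚ
      ≡⟨ +-identityʳ _ ⟩
    otrWeight γ P ∎

module ToOTR {n k : ℕ} {Adj : Fin n → Fin n → Set} {col : Fin n → Fin n → Fin (suc k) → Set}
             (P : PerfectConjoiningMatching Adj col) where
  open PerfectMatching (M' P) using () renaming (edges to edges′; unique to unique′; cover to cover′)

  E : Fin (length edges′) → V' n (suc k) × V' n (suc k)
  E = lookup edges′

  adjacent : ∀ i → Adj' Adj col (proj₁ (E i)) (proj₂ (E i))
  adjacent = isEdge (M' P)

  edgeOf : V' n (suc k) → Fin (length edges′)
  edgeOf u = proj₁ (cover′ u)

  ∈edgeOf : ∀ u → u ∈e E (edgeOf u)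
  ∈edgeOf u = proj₂ (cover′ u)

  edgeOf-unique : ∀ {u i} → u ∈e E i → edgeOf u ≡ i
  edgeOf-unique u∈i = unique′ _ _ _ (∈edgeOf _) u∈i

  partner : Fin n → Fin k → Fin (suc k)
  partner v x = proj₁ (junk∈edge (adjacent (edgeOf (junk v x))) (∈edgeOf (junk v x)))

  partner-edge : ∀ v x → JunkEdge v (partner v x) x (E (edgeOf (junk v x)))
  partner-edge v x = proj₂ (junk∈edge (adjacent (edgeOf (junk v x))) (∈edgeOf (junk v x)))

  partner-injective : ∀ v {x y} → partner v x ≡ partner v y → x ≡ y
  partner-injective v {x} {y} eq = sym (proj₂ (junkEdge-junk (partner-edge v x) y∈edge-x))
    where
    same-edge : edgeOf (junk v y) ≡ edgeOf (junk v x)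
    same-edge = trans (sym (edgeOf-unique (junkEdge-∋copy (partner-edge v y))))
                      (edgeOf-unique (subst (λ c → copy v c ∈e _) eq (junkEdge-∋copy (partner-edge v x))))
    y∈edge-x : junk v y ∈e E (edgeOf (junk v x))
    y∈edge-x = subst (λ i → junk v y ∈e E i) same-edge (∈edgeOf (junk v y))

  layerEdge⇒unpartnered : ∀ {v c i} → LayerEdge (E i) → copy v c ∈e E i → ∀ x → partner v x ≢ c
  layerEdge⇒unpartnered {v} {c} {i} layer v∈i x refl =
    junkEdge-¬layerEdge (partner-edge v x) (subst (LayerEdge ∘ E) (sym same-edge) layer)
    where
    same-edge : edgeOf (junk v x) ≡ i
    same-edge = trans (sym (edgeOf-unique (junkEdge-∋copy (partner-edge v x)))) (edgeOf-unique v∈i)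

  unpartnered⇒layerEdge : ∀ {v c} → (∀ x → partner v x ≢ c) → LayerEdge (E (edgeOf (copy v c)))
  unpartnered⇒layerEdge {v} {c} unpartnered
    with copy∈edge (adjacent (edgeOf (copy v c))) (∈edgeOf (copy v c))
  ... | inj₁ layer          = layer
  ... | inj₂ (x , junkEdge) = ⊥-elim (unpartnered x (sym (proj₂ (junkEdge-copy (partner-edge v x) c∈edge-x))))
    where
    c∈edge-x : copy v c ∈e E (edgeOf (junk v x))
    c∈edge-x = subst (λ i → copy v c ∈e E i) (sym (edgeOf-unique (junkEdge-∋junk junkEdge)))
                     (∈edgeOf (copy v c))

  layers : Enumeration (LayerEdge ∘ E)
  layers = enumerate (layerEdge? ∘ adjacent)

  open Enumeration layers

  F : Fin size → Fin n × Fin n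
  F = endpoints ∘ elem-P

  isPerfect : IsPerfectFamily Adj F
  isPerfect = record
    { adjacent = λ j → proj₁ (layerEdge-adjacent (elem-P j) (adjacent (elem j)))
    ; covering = covering
    ; disjoint = disjoint
    }
    where
    covering : ∀ v → ∃ λ j → v ∈e F j
    covering v =
      let (c , unpartnered) = missedValue (partner v)
          (j , elem-j≡edge) = elem-onto _ (unpartnered⇒layerEdge unpartnered)
          c∈j = subst (λ i → copy v c ∈e E i) (sym elem-j≡edge) (∈edgeOf (copy v c))
      in j , proj₁ (layerEdge-∋copy (elem-P j) c∈j)
    disjoint : ∀ v j j′ → v ∈e F j → v ∈e F j′ → j ≡ j′
    disjoint v j j′ v∈j v∈j′ = elem-injective (unique′ (copy v (colour (elem-P j′))) _ _ c′∈j c′∈j′)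
      where
      c∈j = layerEdge-∋endpoint (elem-P j) v∈j
      c′∈j′ = layerEdge-∋endpoint (elem-P j′) v∈j′
      c≡c′ : colour (elem-P j) ≡ colour (elem-P j′)
      c≡c′ = missedValue-unique (partner v) (partner-injective v)
               (layerEdge⇒unpartnered (elem-P j) c∈j) (layerEdge⇒unpartnered (elem-P j′) c′∈j′)
      c′∈j = subst (λ c → copy v c ∈e E (elem j)) c≡c′ c∈j

  open FromFamily ↔-refl isPerfect

  colouring : Fin (length edgeList) → Fin (suc k)
  colouring i = colour (elem-P (cast length-edgeList i))

  otr : PerfectOTRMatching Adj col
  otr = record
    { M      = perfectMatching
    ; ξ      = colouring
    ; ξ-col  = λ i → subst (λ e → col (proj₁ e) (proj₂ e) (colouring i)) (sym (lookup-edgeList i))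
                            (proj₂ (layerEdge-adjacent (elem-P (index i)) (adjacent (elem (index i)))))
    ; ξ-surj = surjective
    }
    where
    surjective : ∀ c → ∃ λ i → colouring i ≡ c
    surjective c =
      let (i , c∋source , c∋target) = conjoin P c
          (layer , colour≡c) = inLayer⇒layerEdge c (adjacent i) c∋source c∋target
          (j , elem-j≡i) = elem-onto i layer
      in position j , (begin
        colour (elem-P (cast length-edgeList (cast (sym length-edgeList) j)))
          ≡⟨ cong (colour ∘ elem-P) (cast-involutive length-edgeList (sym length-edgeList) j) ⟩
        colour (elem-P j)  ≡⟨ colour-unique (cong E elem-j≡i) (elem-P j) layer ⟩
        colour layer       ≡⟨ colour≡c ⟩
        c                  ∎)

  conjWeight≡otrWeight : ∀ γ → conjWeight γ P ≡ otrWeight γ otr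
  conjWeight≡otrWeight γ = begin
    ∑ (edgeW (γ' γ) ∘ E)
      ≡⟨ ∑-elem _ (weight-¬layerEdge γ ∘ E) ⟩
    ∑ (edgeW (γ' γ) ∘ E ∘ elem)
      ≡⟨ ∑-cong (weight-layerEdge γ ∘ elem-P) ⟩
    ∑ (λ j → γ (proj₁ (F j)) (proj₂ (F j)) (colour (elem-P j)))
      ≡⟨ sym (∑-edgeList (λ j e → γ (proj₁ e) (proj₂ e) (colour (elem-P j)))) ⟩
    otrWeight γ otr ∎

lemma9 : (n k : ℕ) → 1 ≤ k →
    (Adj : Fin n → Fin n → Set) →
    (∀ v w → Adj v w → Adj w v) →
    (∀ v → Adj v v → ⊥) →
    (col : Fin n → Fin n → Fin k → Set) →
    (∀ v w c → col v w c → col w v c) →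
    (∀ v w → Adj v w → ∃ (λ c → col v w c)) →
    (γ : Fin n → Fin n → Fin k → ℚ) →
    (∀ v w c → γ v w c ≡ γ w v c) →
    (∀ v w c → Adj v w → col v w c → 0ℚ ≤ℚ γ v w c) →
    (ℓ : ℚ) →
    (Σ (PerfectOTRMatching Adj col) (λ P → otrWeight γ P ≡ ℓ))
    ⇔ (Σ (PerfectConjoiningMatching Adj col) (λ P → conjWeight γ P ≡ ℓ))
lemma9 n (suc k) (s≤s z≤n) Adj _ _ col _ _ γ _ _ ℓ = mk⇔
  (λ (P , weight≡ℓ) → FromOTR.conjoining P , trans (FromOTR.conjWeight≡otrWeight P γ) weight≡ℓ)
  (λ (P , weight≡ℓ) → ToOTR.otr P , trans (sym (ToOTR.conjWeight≡otrWeight P γ)) weight≡ℓ)
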